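{- Let $\mathcal{P}$ be a pure logic program and $\mathcal{R}_{\mathcal{P}}$ its associated tile system. Let $c\equiv p(t_1,\dots,t_k)\mathrel{:- }q_1(\vec s_1),\dots,q_m(\vec s_m)$ be a clause of $\mathcal{P}$ over variables $x_1,\dots,x_n$, with basic tile $T_c=\langle p,\ id_{\mathsf{p}},\ t,\ G\rangle$ where $t=\langle t_1,\dots,t_k\rangle\colon\mathsf{t}^n\to\mathsf{t}^k$ and $G=q_1(\vec s_1)\wedge\dots\wedge q_m(\vec s_m)\colon\mathsf{t}^n\to\mathsf{p}$. For all arrows $t_1'\colon\mathsf{t}^n\to\mathsf{t}^j$ and $t_2'\colon\mathsf{t}^j\to\mathsf{t}^k$ of the term theory with $t=t_1';t_2'$ and such that $t_2'$ is obtained without using dischargers, the tile $\langle t_2';p,\ id_{\mathsf{p}},\ t_1',\ G\rangle$ is entailed by $\mathcal{R}_{\mathcal{P}}$.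
   Context: Signatures and arrows: a logic program signature has sorts $\mathsf{t}$ (terms) and $\mathsf{p}$ (predicates), function symbols $f\colon\mathsf{t}^n\to\mathsf{t}$ and predicate symbols $p\colon\mathsf{t}^k\to\mathsf{p}$. Arrows are those of the free cartesian (Lawvere) theory: an arrow $w\to w'$ between sort strings is a tuple of terms (of the sorts in $w'$) over variables typed by $w$; composition $\alpha;\beta$ is in diagrammatic order ($\alpha$ first, substituted into $\beta$); $\otimes$ is juxtaposition; auxiliary arrows are symmetries $\gamma$, duplicators $\nabla_{\underline{n}}=\langle x_1,\dots,x_n,x_1,\dots,x_n\rangle$ and dischargers $!_{\underline{n}}$ (empty tuple on $n$ variables). "Obtained without dischargers" means built by $;$ and $\otimes$ from function symbols, identities, symmetries and duplicators. The tile system $\mathcal{R}_{\mathcal{P}}$: configurations are arrows of the free cartesian category generated by function symbols, predicate symbols, the constant $\Box\colon\epsilon\to\mathsf{p}$ and $\wedge\colon\mathsf{p}\mathsf{p}\to\mathsf{p}$ (taken associative with unit $\Box$); observations are arrows of the free cartesian category generated by the function symbols. A tile $\langle s,u,v,r\rangle$ has initial configuration $s\colon o_1\to o_0$, trigger $u\colon o_2\to o_0$, effect $v\colon o_3\to o_1$, final configuration $r\colon o_3\to o_2$ (no commutation required). Basic tiles: for each clause $c$ the tile $T_c$ described in the claim; and the pullback tiles, for each $n$-ary function symbol $f$: $\langle f,f,id,id\rangle$, $\langle f\otimes id_{\underline1},\nabla_{\underline1},\nabla_{\underline n};(id_{\underline n}\otimes f),f\rangle$, $\langle\nabla_{\underline1},f\otimes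 id_{\underline1},f,\nabla_{\underline n};(id_{\underline n}\otimes f)\rangle$, plus $\langle\nabla_{\underline1},\nabla_{\underline1},id_{\underline1},id_{\underline1}\rangle$, $\langle\gamma_{\underline1,\underline1},\gamma_{\underline1,\underline1},id_{\underline2},id_{\underline2}\rangle$, $\langle\nabla_{\underline1}\otimes id_{\underline1},id_{\underline1}\otimes\nabla_{\underline1},\nabla_{\underline1},\nabla_{\underline1}\rangle$ (on sort $\mathsf{t}$). A tile is entailed ($\mathcal{R}_{\mathcal{P}}\vdash$) if obtained from basic tiles and identity tiles $\langle h,id,id,h\rangle$, $\langle id,v,v,id\rangle$ by finitely many compositions: horizontal $\langle s_1,u_1,v_1,r_1\rangle*\langle s_2,v_1,v_2,r_2\rangle=\langle s_2;s_1,u_1,v_2,r_2;r_1\rangle$, vertical $\langle s_1,u_1,v_1,r_1\rangle\cdot\langle r_1,u_2,v_2,r_2\rangle=\langle s_1,u_2;u_1,v_2;v_1,r_2\rangle$, and parallel (componentwise $\otimes$). -}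

module Defs where

open import Data.Nat using (ℕ; zero; suc)
open import Data.List using (List; []; _∷_; _++_; replicate; map)
open import Data.Vec using (Vec) renaming ([] to []ᵛ; _∷_ to _∷ᵛ_)
import Data.Vec as Vec
open import Data.Product using (Σ; _,_)
open import Data.List.Membership.Propositional using (_∈_)

-- Sorts: t (terms) and p (predicates)
data Sort : Set where
  t p : Sort

-- Sort strings (objects of the categories)
Ctx : Set
Ctx = List Sort

tⁿ : ℕ → Ctx
tⁿ n = replicate n t

data _∋_ : Ctx → Sort → Set where
  here  : ∀ {Γ s} → (s ∷ Γ) ∋ s
  there : ∀ {Γ s s'} → Γ ∋ s → (s' ∷ Γ) ∋ s

record Signature : Set₁ where
  field
    Fn : Set
    ar : Fn → ℕ
    Pr : Set
    par : Pr → ℕ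

data Tup (P : Sort → Set) : Ctx → Set where
  []  : Tup P []
  _∷_ : ∀ {s w} → P s → Tup P w → Tup P (s ∷ w)

infixr 5 _∷_

lookupT : ∀ {P w s} → Tup P w → w ∋ s → P s
lookupT (x ∷ _) here = x
lookupT (_ ∷ xs) (there v) = lookupT xs v

mapT : ∀ {P Q : Sort → Set} {w} → (∀ {s} → P s → Q s) → Tup P w → Tup Q w
mapT f [] = []
mapT f (x ∷ xs) = f x ∷ mapT f xs

_+++_ : ∀ {P w w'} → Tup P w → Tup P w' → Tup P (w ++ w')
[] +++ ys = ys
(x ∷ xs) +++ ys = x ∷ (xs +++ ys)

inl : ∀ {a b s} → a ∋ s → (a ++ b) ∋ s
inl here = here
inl (there v) = there (inl v)

inr : ∀ {a b s} → b ∋ s → (a ++ b) ∋ s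
inr {[]} v = v
inr {_ ∷ a} v = there (inr {a} v)

module Sig (S : Signature) where
  open Signature S

  -- terms of sort t over a context (free Lawvere theory on the function symbols)
  data Tm (Γ : Ctx) : Set where
    var : Γ ∋ t → Tm Γ
    fun : (f : Fn) → Vec (Tm Γ) (ar f) → Tm Γ

  data Atom (Γ : Ctx) : Set where
    pvar : Γ ∋ p → Atom Γ
    pred : (q : Pr) → Vec (Tm Γ) (par q) → Atom Γ

  -- Configuration terms. Sort p terms are generated by atoms, □ and ∧ with ∧
  -- associative with unit □: i.e. they are (free-monoid) lists of atoms,
  -- □ = [] and ∧ = list concatenation.
  CT : Ctx → Sort → Set
  CT Γ t = Tm Γ
  CT Γ p = List (Atom Γ)

  -- Observation terms: only function symbols, so sort p terms are variables.
  OT : Ctx → Sort → Set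
  OT Γ t = Tm Γ
  OT Γ p = Γ ∋ p

  -- arrows w → w' : tuples (of the sorts in w') of terms over w
  CArr : Ctx → Ctx → Set
  CArr w w' = Tup (CT w) w'

  OArr : Ctx → Ctx → Set
  OArr w w' = Tup (OT w) w'

  substTm : ∀ {a b} → (b ∋ t → Tm a) → Tm b → Tm a
  substVec : ∀ {a b n} → (b ∋ t → Tm a) → Vec (Tm b) n → Vec (Tm a) n
  substTm ρ (var x) = ρ x
  substTm ρ (fun f ts) = fun f (substVec ρ ts)
  substVec ρ []ᵛ = []ᵛ
  substVec ρ (x ∷ᵛ xs) = substTm ρ x ∷ᵛ substVec ρ xs

  renTm : ∀ {a b} → (∀ {s} → b ∋ s → a ∋ s) → Tm b → Tm a
  renTm r = substTm (λ x → var (r x))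

  substAtoms : ∀ {a b} → CArr a b → List (Atom b) → List (Atom a)
  substAtoms σ [] = []
  substAtoms σ (pvar x ∷ as) = lookupT σ x ++ substAtoms σ as
  substAtoms σ (pred q ts ∷ as) = pred q (substVec (lookupT σ) ts) ∷ substAtoms σ as

  substC : ∀ {a b} → CArr a b → ∀ {s} → CT b s → CT a s
  substC σ {t} u = substTm (lookupT σ) u
  substC σ {p} u = substAtoms σ u

  substO : ∀ {a b} → OArr a b → ∀ {s} → OT b s → OT a s
  substO σ {t} u = substTm (lookupT σ) u
  substO σ {p} x = lookupT σ x

  renC : ∀ {a b} → (∀ {s} → b ∋ s → a ∋ s) → ∀ {s} → CT b s → CT a s
  renC r {t} u = renTm r u
  renC r {p} as = Data.List.map renA as
    where
      renA : Atom _ → Atom _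
      renA (pvar x) = pvar (r x)
      renA (pred q ts) = pred q (Vec.map (renTm r) ts)

  renO : ∀ {a b} → (∀ {s} → b ∋ s → a ∋ s) → ∀ {s} → OT b s → OT a s
  renO r {t} u = renTm r u
  renO r {p} x = r x

  -- composition in diagrammatic order: α ; β substitutes α into β
  infixl 7 _⨾_ _⨾ᶜ_
  _⨾_ : ∀ {a b c} → OArr a b → OArr b c → OArr a c
  α ⨾ β = mapT (substO α) β

  _⨾ᶜ_ : ∀ {a b c} → CArr a b → CArr b c → CArr a c
  α ⨾ᶜ β = mapT (substC α) β

  infixr 8 _⊗_ _⊗ᶜ_
  _⊗_ : ∀ {a b c d} → OArr a b → OArr c d → OArr (a ++ c) (b ++ d)
  _⊗_ {a} {c = c} α β = mapT (renO (inl {a} {c})) α +++ mapT (renO (inr {a} {c})) β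

  _⊗ᶜ_ : ∀ {a b c d} → CArr a b → CArr c d → CArr (a ++ c) (b ++ d)
  _⊗ᶜ_ {a} {c = c} α β = mapT (renC (inl {a} {c})) α +++ mapT (renC (inr {a} {c})) β

  varsO : ∀ {Γ} (w : Ctx) → (∀ {s} → w ∋ s → Γ ∋ s) → OArr Γ w
  varsO [] r = []
  varsO (t ∷ w) r = var (r here) ∷ varsO w (λ x → r (there x))
  varsO (p ∷ w) r = r here ∷ varsO w (λ x → r (there x))

  emb : ∀ {Γ s} → OT Γ s → CT Γ s
  emb {s = t} u = u
  emb {s = p} x = pvar x ∷ []

  embO : ∀ {a b} → OArr a b → CArr a b
  embO = mapT emb

  idO : ∀ {w} → OArr w w
  idO {w} = varsO w (λ x → x)

  idC : ∀ {w} → CArr w w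
  idC = embO idO

  γ : (a b : Ctx) → OArr (a ++ b) (b ++ a)
  γ a b = varsO b (inr {a} {b}) +++ varsO a (inl {a} {b})

  ∇ : (w : Ctx) → OArr w (w ++ w)
  ∇ w = idO {w} +++ idO {w}

  allVars : (n : ℕ) → Vec (Tm (tⁿ n)) n
  allVars zero = []ᵛ
  allVars (suc n) = var here ∷ᵛ Vec.map (renTm there) (allVars n)

  fromVec : ∀ {Γ n} → Vec (Tm Γ) n → OArr Γ (tⁿ n)
  fromVec []ᵛ = []
  fromVec (x ∷ᵛ xs) = x ∷ fromVec xs

  funArr : (f : Fn) → OArr (tⁿ (ar f)) (t ∷ [])
  funArr f = fun f (allVars (ar f)) ∷ []

  predArr : (q : Pr) → CArr (tⁿ (par q)) (p ∷ [])
  predArr q = (pred q (allVars (par q)) ∷ []) ∷ []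

  data NoDisch : ∀ {a b} → OArr a b → Set where
    nd-fun : (f : Fn) → NoDisch (funArr f)
    nd-id  : (n : ℕ) → NoDisch (idO {tⁿ n})
    nd-γ   : (n m : ℕ) → NoDisch (γ (tⁿ n) (tⁿ m))
    nd-∇   : (n : ℕ) → NoDisch (∇ (tⁿ n))
    nd-⨾   : ∀ {a b c} {α : OArr a b} {β : OArr b c} → NoDisch α → NoDisch β → NoDisch (α ⨾ β)
    nd-⊗   : ∀ {a b c d} {α : OArr a b} {β : OArr c d} → NoDisch α → NoDisch β → NoDisch (α ⊗ β)

  -- a clause  p(t₁,…,t_k) :- q₁(s⃗₁), …, q_m(s⃗_m)  over variables x₁ … xₙ
  record Clause : Set where
    field
      nvars : ℕ
      hd    : Pr
      args  : Vec (Tm (tⁿ nvars)) (par hd)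
      body  : List (Σ Pr (λ q → Vec (Tm (tⁿ nvars)) (par q)))

  Program : Set
  Program = List Clause

  module _ (c : Clause) where
    open Clause c
    headArr : OArr (tⁿ nvars) (tⁿ (par hd))
    headArr = fromVec args

    bodyArr : CArr (tⁿ nvars) (p ∷ [])
    bodyArr = map (λ { (q , ss) → pred q ss }) body ∷ []

  -- entailment in the tile system R_P ;  tile ⟨s,u,v,r⟩ with
  -- s : o₁ → o₀, u : o₂ → o₀, v : o₃ → o₁, r : o₃ → o₂
  data Ent (P : Program) : ∀ {o₀ o₁ o₂ o₃} →
        CArr o₁ o₀ → OArr o₂ o₀ → OArr o₃ o₁ → CArr o₃ o₂ → Set where
    tile-c : (c : Clause) → c ∈ P →
      Ent P (predArr (Clause.hd c)) (idO {p ∷ []}) (headArr c) (bodyArr c)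
    pb-f : (f : Fn) → Ent P (embO (funArr f)) (funArr f) idO idC
    pb-f∇ : (f : Fn) →
      Ent P (embO (funArr f ⊗ idO {t ∷ []})) (∇ (t ∷ []))
            (∇ (tⁿ (ar f)) ⨾ (idO {tⁿ (ar f)} ⊗ funArr f)) (embO (funArr f))
    pb-∇f : (f : Fn) →
      Ent P (embO (∇ (t ∷ []))) (funArr f ⊗ idO {t ∷ []}) (funArr f)
            (embO (∇ (tⁿ (ar f)) ⨾ (idO {tⁿ (ar f)} ⊗ funArr f)))
    pb-∇∇ : Ent P (embO (∇ (t ∷ []))) (∇ (t ∷ [])) (idO {t ∷ []}) (idC {t ∷ []})
    pb-γγ : Ent P (embO (γ (t ∷ []) (t ∷ []))) (γ (t ∷ []) (t ∷ []))
                  (idO {t ∷ t ∷ []}) (idC {t ∷ t ∷ []})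
    pb-∇∇∇ : Ent P (embO (∇ (t ∷ []) ⊗ idO {t ∷ []})) (idO {t ∷ []} ⊗ ∇ (t ∷ []))
                   (∇ (t ∷ [])) (embO (∇ (t ∷ [])))
    id-h : ∀ {a b} (h : CArr a b) → Ent P h idO idO h
    id-v : ∀ {a b} (v : OArr a b) → Ent P idC v v idC
    hor : ∀ {o₀ o₁ o₂ o₃ o₁' o₃'}
      {s₁ : CArr o₁ o₀} {u₁ : OArr o₂ o₀} {v₁ : OArr o₃ o₁} {r₁ : CArr o₃ o₂}
      {s₂ : CArr o₁' o₁} {v₂ : OArr o₃' o₁'} {r₂ : CArr o₃' o₃} →
      Ent P s₁ u₁ v₁ r₁ → Ent P s₂ v₁ v₂ r₂ → Ent P (s₂ ⨾ᶜ s₁) u₁ v₂ (r₂ ⨾ᶜ r₁)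
    ver : ∀ {o₀ o₁ o₂ o₃ o₂' o₃'}
      {s₁ : CArr o₁ o₀} {u₁ : OArr o₂ o₀} {v₁ : OArr o₃ o₁} {r₁ : CArr o₃ o₂}
      {u₂ : OArr o₂' o₂} {v₂ : OArr o₃' o₃} {r₂ : CArr o₃' o₂'} →
      Ent P s₁ u₁ v₁ r₁ → Ent P r₁ u₂ v₂ r₂ → Ent P s₁ (u₂ ⨾ u₁) (v₂ ⨾ v₁) r₂
    prl : ∀ {o₀ o₁ o₂ o₃ o₀' o₁' o₂' o₃'}
      {s : CArr o₁ o₀} {u : OArr o₂ o₀} {v : OArr o₃ o₁} {r : CArr o₃ o₂}
      {s' : CArr o₁' o₀'} {u' : OArr o₂' o₀'} {v' : OArr o₃' o₁'} {r' : CArr o₃' o₂'} →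
      Ent P s u v r → Ent P s' u' v' r' → Ent P (s ⊗ᶜ s') (u ⊗ u') (v ⊗ v') (r ⊗ᶜ r')

-- The clause tile T_c has effect t = t₁' ⨾ t₂'. Call ⟨α, α, id, id⟩ the self tile of α. The self
-- tiles of function symbols, of γ₁,₁ and of ∇₁ are basic pullback tiles, and self tiles are closed
-- under ⨾ (a vertical, then a horizontal composition) and ⊗ (parallel composition). Since γ and ∇
-- on n wires decompose into γ₁,₁ and ∇₁ by moving one wire at a time, every discharger-free t₂' has
-- a self tile. Its vertical composite with the identity tile of t₁' is ⟨t₂', t, t₁', id⟩, and the
-- horizontal composite of T_c with this tile is the required tile.
module Submission where

open import Defs
open import Data.Nat using (ℕ; zero; suc)
open import Data.List using (List; []; _∷_; _++_)
open import Data.List.Membership.Propositional using (_∈_)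
open import Data.Vec using (Vec) renaming ([] to []ᵛ; _∷_ to _∷ᵛ_)
open import Function using (_∘_)
open import Relation.Binary.PropositionalEquality

Tup-ext : ∀ {Q w} {σ τ : Tup Q w} → (∀ {s} (x : w ∋ s) → lookupT σ x ≡ lookupT τ x) → σ ≡ τ
Tup-ext {σ = []}    {[]}    eq = refl
Tup-ext {σ = _ ∷ _} {_ ∷ _} eq = cong₂ _∷_ (eq here) (Tup-ext (eq ∘ there))

lookupT-mapT : ∀ {Q R : Sort → Set} {w s} (f : ∀ {s} → Q s → R s) (σ : Tup Q w) (x : w ∋ s) →
  lookupT (mapT f σ) x ≡ f (lookupT σ x)
lookupT-mapT f (_ ∷ σ) here      = refl
lookupT-mapT f (_ ∷ σ) (there x) = lookupT-mapT f σ x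

mapT-+++ : ∀ {Q R : Sort → Set} {w w'} (f : ∀ {s} → Q s → R s) (σ : Tup Q w) (τ : Tup Q w') →
  mapT f (σ +++ τ) ≡ mapT f σ +++ mapT f τ
mapT-+++ f []      τ = refl
mapT-+++ f (x ∷ σ) τ = cong (f x ∷_) (mapT-+++ f σ τ)

mapT-commute : ∀ {Q R R' T : Sort → Set} {w}
  {f : ∀ {s} → R s → T s} {g : ∀ {s} → Q s → R s} {h : ∀ {s} → R' s → T s} {k : ∀ {s} → Q s → R' s} →
  (∀ {s} (u : Q s) → f (g u) ≡ h (k u)) → (σ : Tup Q w) → mapT f (mapT g σ) ≡ mapT h (mapT k σ)
mapT-commute eq []      = refl
mapT-commute eq (u ∷ σ) = cong₂ _∷_ (eq u) (mapT-commute eq σ)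

-- r : Ren Γ w presents the arrow ⟪ r ⟫ : Γ → w (defined below) whose components are the variables
-- r x; the identities, γ and ∇ are of this form.
Ren : Ctx → Ctx → Set
Ren Γ w = ∀ {s} → w ∋ s → Γ ∋ s

infix 4 _≗ᴿ_
_≗ᴿ_ : ∀ {Γ w} → Ren Γ w → Ren Γ w → Set
_≗ᴿ_ {w = w} r r' = ∀ {s} (x : w ∋ s) → r x ≡ r' x

[_,_] : ∀ {Γ b d} → Ren Γ b → Ren Γ d → Ren Γ (b ++ d)
[_,_] {b = []}    f g x         = g x
[_,_] {b = _ ∷ _} f g here      = f here
[_,_] {b = _ ∷ b} f g (there x) = [_,_] {b = b} (f ∘ there) g x

[,]-inl : ∀ {Γ b d} (f : Ren Γ b) (g : Ren Γ d) {s} (y : b ∋ s) → [ f , g ] (inl {b} {d} y) ≡ f y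
[,]-inl f g here      = refl
[,]-inl f g (there y) = [,]-inl (f ∘ there) g y

[,]-inr : ∀ {Γ} b {d} (f : Ren Γ b) (g : Ren Γ d) {s} (z : d ∋ s) → [ f , g ] (inr {b} {d} z) ≡ g z
[,]-inr []      f g z = refl
[,]-inr (_ ∷ b) f g z = [,]-inr b (f ∘ there) g z

++-ext : ∀ b {d Γ} {r r' : Ren Γ (b ++ d)} →
  r ∘ inl {b} {d} ≗ᴿ r' ∘ inl {b} {d} → r ∘ inr {b} {d} ≗ᴿ r' ∘ inr {b} {d} → r ≗ᴿ r'
++-ext []      on-inl on-inr x         = on-inr x
++-ext (_ ∷ b) on-inl on-inr here      = on-inl here
++-ext (_ ∷ b) on-inl on-inr (there x) = ++-ext b (on-inl ∘ there) on-inr x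

idᴿ : ∀ {w} → Ren w w
idᴿ x = x

infixr 8 _⊕_
_⊕_ : ∀ {a b c d} → Ren a b → Ren c d → Ren (a ++ c) (b ++ d)
_⊕_ {a} {c = c} r r' = [ inl {a} {c} ∘ r , inr {a} {c} ∘ r' ]

swap : ∀ a b → Ren (a ++ b) (b ++ a)
swap a b = [ inr {a} {b} , inl {a} {b} ]

diag : ∀ a → Ren a (a ++ a)
diag a = [ idᴿ , idᴿ ]

insert : ∀ {u} b {a} → Ren (u ∷ (b ++ a)) (b ++ u ∷ a)
insert {u} b {a} = [ there ∘ inl {b} {a} , idᴿ {u ∷ []} ⊕ inr {b} {a} ]

⊕-identity : ∀ a {c} → idᴿ {a} ⊕ idᴿ {c} ≗ᴿ idᴿ
⊕-identity a {c} = ++-ext a ([,]-inl (inl {a} {c}) (inr {a})) ([,]-inr a (inl {a} {c}) (inr {a}))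

swap-inl : ∀ a b {s} (y : b ∋ s) → swap a b (inl {b} {a} y) ≡ inr {a} {b} y
swap-inl a b = [,]-inl (inr {a} {b}) (inl {a} {b})

swap-inr : ∀ a b {s} (z : a ∋ s) → swap a b (inr {b} {a} z) ≡ inl {a} {b} z
swap-inr a b = [,]-inr b (inr {a} {b}) (inl {a} {b})

diag-inl : ∀ a {s} (y : a ∋ s) → diag a (inl {a} {a} y) ≡ y
diag-inl a = [,]-inl idᴿ idᴿ

diag-inr : ∀ a {s} (z : a ∋ s) → diag a (inr {a} {a} z) ≡ z
diag-inr a = [,]-inr a idᴿ idᴿ

insert-inl : ∀ {u} b {a s} (y : b ∋ s) → insert {u} b {a} (inl {b} {u ∷ a} y) ≡ there (inl {b} {a} y)
insert-inl b {a} = [,]-inl (there ∘ inl {b} {a}) _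

insert-inr : ∀ {u} b {a s} (z : (u ∷ a) ∋ s) → insert {u} b {a} (inr {b} z) ≡ (idᴿ {u ∷ []} ⊕ inr {b} {a}) z
insert-inr b {a} = [,]-inr b (there ∘ inl {b} {a}) _

insert-[] : ∀ {u a} → insert {u} [] {a} ≗ᴿ idᴿ
insert-[] here      = refl
insert-[] (there z) = refl

insert-∷ : ∀ {u s} b {a} →
  insert {u} (s ∷ b) {a} ≗ᴿ (swap (u ∷ []) (s ∷ []) ⊕ idᴿ {b ++ a}) ∘ (idᴿ {s ∷ []} ⊕ insert b)
insert-∷ {u} {s} b {a} = ++-ext (s ∷ b) on-inl on-inr
  where
  outer : Ren (u ∷ s ∷ (b ++ a)) (s ∷ u ∷ (b ++ a))
  outer = swap (u ∷ []) (s ∷ []) ⊕ idᴿ {b ++ a}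
  rhs : Ren (u ∷ s ∷ (b ++ a)) (s ∷ (b ++ u ∷ a))
  rhs = outer ∘ (idᴿ {s ∷ []} ⊕ insert b)
  on-inl : insert (s ∷ b) ∘ inl {s ∷ b} {u ∷ a} ≗ᴿ rhs ∘ inl {s ∷ b} {u ∷ a}
  on-inl here      = refl
  on-inl (there y) = trans (insert-inl (s ∷ b) (there y)) (sym (cong (outer ∘ there) (insert-inl b y)))
  on-inr : insert (s ∷ b) ∘ inr {s ∷ b} {u ∷ a} ≗ᴿ rhs ∘ inr {s ∷ b} {u ∷ a}
  on-inr here      = trans (insert-inr (s ∷ b) here) (sym (cong (outer ∘ there) (insert-inr b here)))
  on-inr (there z) = trans (insert-inr (s ∷ b) (there z))
    (sym (cong (outer ∘ there) (insert-inr b (there z))))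

swap-[]-∷ : ∀ {s} b → swap [] (s ∷ b) ≗ᴿ idᴿ {s ∷ []} ⊕ swap [] b
swap-[]-∷ {s} b = ++-ext (s ∷ b) on-inl λ ()
  where
  on-inl : swap [] (s ∷ b) ∘ inl {s ∷ b} {[]} ≗ᴿ (idᴿ {s ∷ []} ⊕ swap [] b) ∘ inl {s ∷ b} {[]}
  on-inl here      = refl
  on-inl (there y) = trans (swap-inl [] (s ∷ b) (there y)) (sym (cong there (swap-inl [] b y)))

swap-∷ : ∀ {u} a b → swap (u ∷ a) b ≗ᴿ (idᴿ {u ∷ []} ⊕ swap a b) ∘ insert b
swap-∷ {u} a b = ++-ext b on-inl on-inr
  where
  outer : Ren (u ∷ (a ++ b)) (u ∷ (b ++ a))
  outer = idᴿ {u ∷ []} ⊕ swap a b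
  on-inl : swap (u ∷ a) b ∘ inl {b} {u ∷ a} ≗ᴿ (outer ∘ insert b) ∘ inl {b} {u ∷ a}
  on-inl y = trans (swap-inl (u ∷ a) b y)
    (sym (trans (cong outer (insert-inl b y)) (cong there (swap-inl a b y))))
  on-inr : swap (u ∷ a) b ∘ inr {b} {u ∷ a} ≗ᴿ (outer ∘ insert b) ∘ inr {b} {u ∷ a}
  on-inr here      = trans (swap-inr (u ∷ a) b here) (sym (cong outer (insert-inr b here)))
  on-inr (there z) = trans (swap-inr (u ∷ a) b (there z))
    (sym (trans (cong outer (insert-inr b (there z))) (cong there (swap-inr a b z))))

diag-∷ : ∀ {u} a → diag (u ∷ a) ≗ᴿ (diag (u ∷ []) ⊕ diag a) ∘ (idᴿ {u ∷ []} ⊕ insert a)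
diag-∷ {u} a = ++-ext (u ∷ a) on-inl on-inr
  where
  outer : Ren (u ∷ a) (u ∷ u ∷ (a ++ a))
  outer = diag (u ∷ []) ⊕ diag a
  rhs : Ren (u ∷ a) (u ∷ (a ++ u ∷ a))
  rhs = outer ∘ (idᴿ {u ∷ []} ⊕ insert a)
  on-inl : diag (u ∷ a) ∘ inl {u ∷ a} {u ∷ a} ≗ᴿ rhs ∘ inl {u ∷ a} {u ∷ a}
  on-inl here      = refl
  on-inl (there y) = trans (diag-inl (u ∷ a) (there y))
    (sym (trans (cong (outer ∘ there) (insert-inl a y)) (cong there (diag-inl a y))))
  on-inr : diag (u ∷ a) ∘ inr {u ∷ a} {u ∷ a} ≗ᴿ rhs ∘ inr {u ∷ a} {u ∷ a}
  on-inr here      = trans (diag-inr (u ∷ a) here) (sym (cong (outer ∘ there) (insert-inr a here)))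
  on-inr (there z) = trans (diag-inr (u ∷ a) (there z))
    (sym (trans (cong (outer ∘ there) (insert-inr a (there z))) (cong there (diag-inr a z))))

module Arrows (S : Signature) where
  open Sig S

  varO : ∀ {Γ s} → Γ ∋ s → OT Γ s
  varO {s = t} x = var x
  varO {s = p} x = x

  ⟪_⟫ : ∀ {Γ w} → Ren Γ w → OArr Γ w
  ⟪_⟫ {w = w} r = varsO w r

  lookupT-⟪⟫ : ∀ {Γ} w (r : Ren Γ w) {s} (x : w ∋ s) → lookupT ⟪ r ⟫ x ≡ varO (r x)
  lookupT-⟪⟫ (t ∷ w) r here      = refl
  lookupT-⟪⟫ (p ∷ w) r here      = refl
  lookupT-⟪⟫ (t ∷ w) r (there x) = lookupT-⟪⟫ w (r ∘ there) x
  lookupT-⟪⟫ (p ∷ w) r (there x) = lookupT-⟪⟫ w (r ∘ there) x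

  ⟪⟫-cong : ∀ {Γ w} {r r' : Ren Γ w} → r ≗ᴿ r' → ⟪ r ⟫ ≡ ⟪ r' ⟫
  ⟪⟫-cong {w = w} {r} {r'} eq = Tup-ext λ x → begin
    lookupT ⟪ r ⟫ x   ≡⟨ lookupT-⟪⟫ w r x ⟩
    varO (r x)        ≡⟨ cong varO (eq x) ⟩
    varO (r' x)       ≡⟨ lookupT-⟪⟫ w r' x ⟨
    lookupT ⟪ r' ⟫ x  ∎
    where open ≡-Reasoning

  varsO-+++ : ∀ {Γ} b d (f : Ren Γ b) (g : Ren Γ d) → varsO b f +++ varsO d g ≡ ⟪ [ f , g ] ⟫
  varsO-+++ []      d f g = refl
  varsO-+++ (t ∷ b) d f g = cong (_ ∷_) (varsO-+++ b d (f ∘ there) g)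
  varsO-+++ (p ∷ b) d f g = cong (_ ∷_) (varsO-+++ b d (f ∘ there) g)

  renO-varsO : ∀ {Γ Δ} w (h : Ren Δ Γ) (r : Ren Γ w) → mapT (renO h) (varsO w r) ≡ ⟪ h ∘ r ⟫
  renO-varsO []      h r = refl
  renO-varsO (t ∷ w) h r = cong (_ ∷_) (renO-varsO w h (r ∘ there))
  renO-varsO (p ∷ w) h r = cong (_ ∷_) (renO-varsO w h (r ∘ there))

  substO-varO : ∀ {a b s} (σ : OArr a b) (x : b ∋ s) → substO σ (varO x) ≡ lookupT σ x
  substO-varO {s = t} σ x = refl
  substO-varO {s = p} σ x = refl

  lookupT-⨾-⟪⟫ : ∀ {a b w} (σ : OArr a b) (r : Ren b w) {s} (x : w ∋ s) →
    lookupT (σ ⨾ ⟪ r ⟫) x ≡ lookupT σ (r x)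
  lookupT-⨾-⟪⟫ {w = w} σ r x = begin
    lookupT (σ ⨾ ⟪ r ⟫) x     ≡⟨ lookupT-mapT (substO σ) ⟪ r ⟫ x ⟩
    substO σ (lookupT ⟪ r ⟫ x) ≡⟨ cong (substO σ) (lookupT-⟪⟫ w r x) ⟩
    substO σ (varO (r x))      ≡⟨ substO-varO σ (r x) ⟩
    lookupT σ (r x)            ∎
    where open ≡-Reasoning

  ⨾-identityʳ : ∀ {a b} (α : OArr a b) → α ⨾ idO ≡ α
  ⨾-identityʳ α = Tup-ext (lookupT-⨾-⟪⟫ α idᴿ)

  ⟪⟫-∘ : ∀ {Γ b c} (r : Ren Γ b) (r' : Ren b c) → ⟪ r ⟫ ⨾ ⟪ r' ⟫ ≡ ⟪ r ∘ r' ⟫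
  ⟪⟫-∘ {b = b} {c} r r' = Tup-ext λ x →
    trans (lookupT-⨾-⟪⟫ ⟪ r ⟫ r' x) (trans (lookupT-⟪⟫ b r (r' x)) (sym (lookupT-⟪⟫ c (r ∘ r') x)))

  ⟪⟫-⊕ : ∀ {a b c d} (r : Ren a b) (r' : Ren c d) → ⟪ r ⟫ ⊗ ⟪ r' ⟫ ≡ ⟪ r ⊕ r' ⟫
  ⟪⟫-⊕ {a} {b} {c} {d} r r' =
    trans (cong₂ _+++_ (renO-varsO b (inl {a} {c}) r) (renO-varsO d (inr {a} {c}) r'))
          (varsO-+++ b d _ _)

  γ-⟪⟫ : ∀ a b → γ a b ≡ ⟪ swap a b ⟫
  γ-⟪⟫ a b = varsO-+++ b a _ _

  ∇-⟪⟫ : ∀ a → ∇ a ≡ ⟪ diag a ⟫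
  ∇-⟪⟫ a = varsO-+++ a a _ _

  idO-⊗-idO : ∀ {a c} → idO {a} ⊗ idO {c} ≡ idO
  idO-⊗-idO {a} {c} = trans (⟪⟫-⊕ (idᴿ {a}) (idᴿ {c})) (⟪⟫-cong (⊕-identity a))

  substTm-cong : ∀ {a b} {ρ ρ' : b ∋ t → Tm a} → (∀ x → ρ x ≡ ρ' x) →
    ∀ u → substTm ρ u ≡ substTm ρ' u
  substVec-cong : ∀ {a b n} {ρ ρ' : b ∋ t → Tm a} → (∀ x → ρ x ≡ ρ' x) →
    (us : Vec (Tm b) n) → substVec ρ us ≡ substVec ρ' us
  substTm-cong eq (var x)    = eq x
  substTm-cong eq (fun f us) = cong (fun f) (substVec-cong eq us)
  substVec-cong eq []ᵛ       = refl
  substVec-cong eq (u ∷ᵛ us) = cong₂ _∷ᵛ_ (substTm-cong eq u) (substVec-cong eq us)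

  substTm-id : ∀ {a} {ρ : a ∋ t → Tm a} → (∀ x → ρ x ≡ var x) → ∀ u → substTm ρ u ≡ u
  substVec-id : ∀ {a n} {ρ : a ∋ t → Tm a} → (∀ x → ρ x ≡ var x) →
    (us : Vec (Tm a) n) → substVec ρ us ≡ us
  substTm-id eq (var x)    = eq x
  substTm-id eq (fun f us) = cong (fun f) (substVec-id eq us)
  substVec-id eq []ᵛ       = refl
  substVec-id eq (u ∷ᵛ us) = cong₂ _∷ᵛ_ (substTm-id eq u) (substVec-id eq us)

  lookupT-idC : ∀ {w s} (x : w ∋ s) → lookupT (idC {w}) x ≡ emb (varO x)
  lookupT-idC {w} x = trans (lookupT-mapT emb idO x) (cong emb (lookupT-⟪⟫ w idᴿ x))

  substAtoms-idC : ∀ {w} (as : List (Atom w)) → substAtoms idC as ≡ as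
  substAtoms-idC []               = refl
  substAtoms-idC (pvar x ∷ as)    = cong₂ _++_ (lookupT-idC x) (substAtoms-idC as)
  substAtoms-idC (pred q us ∷ as) =
    cong₂ _∷_ (cong (pred q) (substVec-id lookupT-idC us)) (substAtoms-idC as)

  substC-idC : ∀ {w s} (u : CT w s) → substC idC u ≡ u
  substC-idC {s = t} u = substTm-id lookupT-idC u
  substC-idC {s = p} u = substAtoms-idC u

  idC-⨾ᶜ : ∀ {a b} (β : CArr a b) → idC ⨾ᶜ β ≡ β
  idC-⨾ᶜ β = Tup-ext λ x → trans (lookupT-mapT (substC idC) β x) (substC-idC (lookupT β x))

  substC-emb : ∀ {a b s} (α : OArr a b) (u : OT b s) → substC (embO α) (emb u) ≡ emb (substO α u)
  substC-emb {s = t} α u = substTm-cong (lookupT-mapT emb α) u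
  substC-emb {s = p} α x = cong₂ _++_ (lookupT-mapT emb α x) refl

  embO-⨾ : ∀ {a b c} (α : OArr a b) (β : OArr b c) → embO α ⨾ᶜ embO β ≡ embO (α ⨾ β)
  embO-⨾ α β = mapT-commute (substC-emb α) β

  renC-emb : ∀ {a b s} (r : Ren a b) (u : OT b s) → renC r (emb u) ≡ emb (renO r u)
  renC-emb {s = t} r u = refl
  renC-emb {s = p} r x = refl

  embO-⊗ : ∀ {a b c d} (α : OArr a b) (β : OArr c d) → embO α ⊗ᶜ embO β ≡ embO (α ⊗ β)
  embO-⊗ {a} {b} {c} {d} α β = begin
    embO α ⊗ᶜ embO β     ≡⟨ cong₂ _+++_ (mapT-commute (renC-emb (inl {a} {c})) α)
                                         (mapT-commute (renC-emb (inr {a} {c})) β) ⟩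
    embO α' +++ embO β'  ≡⟨ mapT-+++ emb α' β' ⟨
    embO (α ⊗ β)         ∎
    where
    open ≡-Reasoning
    α' : OArr (a ++ c) b
    α' = mapT (renO (inl {a} {c})) α
    β' : OArr (a ++ c) d
    β' = mapT (renO (inr {a} {c})) β

module Tiles (S : Signature) (P : Sig.Program S) where
  open Sig S
  open Arrows S

  Ent-cast : ∀ {o₀ o₁ o₂ o₃}
    {s s' : CArr o₁ o₀} {u u' : OArr o₂ o₀} {v v' : OArr o₃ o₁} {r r' : CArr o₃ o₂} →
    s ≡ s' → u ≡ u' → v ≡ v' → r ≡ r' → Ent P s u v r → Ent P s' u' v' r'
  Ent-cast refl refl refl refl e = e

  SelfTile : ∀ {a b} → OArr a b → Set
  SelfTile α = Ent P (embO α) α idO idC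

  selfTile-after : ∀ {a b c} (α : OArr a b) {β : OArr b c} → SelfTile β → Ent P (embO β) (α ⨾ β) α idC
  selfTile-after α tβ = Ent-cast refl refl (⨾-identityʳ α) refl (ver tβ (id-v α))

  selfTile-idO : ∀ {w} → SelfTile (idO {w})
  selfTile-idO = id-v idO

  selfTile-⨾ : ∀ {a b c} {α : OArr a b} {β : OArr b c} → SelfTile α → SelfTile β → SelfTile (α ⨾ β)
  selfTile-⨾ {α = α} {β} tα tβ =
    Ent-cast (embO-⨾ α β) refl refl (idC-⨾ᶜ idC) (hor (selfTile-after α tβ) tα)

  selfTile-⊗ : ∀ {a b c d} {α : OArr a b} {β : OArr c d} → SelfTile α → SelfTile β → SelfTile (α ⊗ β)
  selfTile-⊗ {a} {c = c} {α = α} {β} tα tβ =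
    Ent-cast (embO-⊗ α β) refl (idO-⊗-idO {a} {c}) idC⊗idC (prl tα tβ)
    where
    idC⊗idC : idC {a} ⊗ᶜ idC {c} ≡ idC
    idC⊗idC = trans (embO-⊗ (idO {a}) (idO {c})) (cong embO (idO-⊗-idO {a} {c}))

  -- A record rather than an abbreviation, so that r can be inferred from a proof of SelfTileᴿ r.
  record SelfTileᴿ {Γ w} (r : Ren Γ w) : Set where
    constructor selfTileᴿ
    field selfTile : SelfTile ⟪ r ⟫
  open SelfTileᴿ

  selfTileᴿ-≗ : ∀ {Γ w} {r r' : Ren Γ w} → r ≗ᴿ r' → SelfTileᴿ r' → SelfTileᴿ r
  selfTileᴿ-≗ eq (selfTileᴿ tr') = selfTileᴿ (subst SelfTile (sym (⟪⟫-cong eq)) tr')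

  selfTileᴿ-id : ∀ {w} → SelfTileᴿ (idᴿ {w})
  selfTileᴿ-id = selfTileᴿ selfTile-idO

  selfTileᴿ-∘ : ∀ {Γ b c} {r : Ren Γ b} {r' : Ren b c} → SelfTileᴿ r → SelfTileᴿ r' → SelfTileᴿ (r ∘ r')
  selfTileᴿ-∘ {r = r} {r'} (selfTileᴿ tr) (selfTileᴿ tr') =
    selfTileᴿ (subst SelfTile (⟪⟫-∘ r r') (selfTile-⨾ tr tr'))

  selfTileᴿ-⊕ : ∀ {a b c d} {r : Ren a b} {r' : Ren c d} → SelfTileᴿ r → SelfTileᴿ r' → SelfTileᴿ (r ⊕ r')
  selfTileᴿ-⊕ {r = r} {r'} (selfTileᴿ tr) (selfTileᴿ tr') =
    selfTileᴿ (subst SelfTile (⟪⟫-⊕ r r') (selfTile-⊗ tr tr'))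

  selfTileᴿ-swap₁ : SelfTileᴿ (swap (t ∷ []) (t ∷ []))
  selfTileᴿ-swap₁ = selfTileᴿ (subst SelfTile (γ-⟪⟫ (t ∷ []) (t ∷ [])) pb-γγ)

  selfTileᴿ-diag₁ : SelfTileᴿ (diag (t ∷ []))
  selfTileᴿ-diag₁ = selfTileᴿ (subst SelfTile (∇-⟪⟫ (t ∷ [])) pb-∇∇)

  selfTileᴿ-insert : ∀ n {a} → SelfTileᴿ (insert {t} (tⁿ n) {a})
  selfTileᴿ-insert zero    = selfTileᴿ-≗ insert-[] selfTileᴿ-id
  selfTileᴿ-insert (suc n) = selfTileᴿ-≗ (insert-∷ (tⁿ n))
    (selfTileᴿ-∘ (selfTileᴿ-⊕ selfTileᴿ-swap₁ selfTileᴿ-id)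
                 (selfTileᴿ-⊕ selfTileᴿ-id (selfTileᴿ-insert n)))

  selfTileᴿ-swap-[] : ∀ m → SelfTileᴿ (swap [] (tⁿ m))
  selfTileᴿ-swap-[] zero    = selfTileᴿ-≗ (λ ()) selfTileᴿ-id
  selfTileᴿ-swap-[] (suc m) =
    selfTileᴿ-≗ (swap-[]-∷ (tⁿ m)) (selfTileᴿ-⊕ selfTileᴿ-id (selfTileᴿ-swap-[] m))

  selfTileᴿ-swap : ∀ n m → SelfTileᴿ (swap (tⁿ n) (tⁿ m))
  selfTileᴿ-swap zero    m = selfTileᴿ-swap-[] m
  selfTileᴿ-swap (suc n) m = selfTileᴿ-≗ (swap-∷ (tⁿ n) (tⁿ m))
    (selfTileᴿ-∘ (selfTileᴿ-⊕ selfTileᴿ-id (selfTileᴿ-swap n m)) (selfTileᴿ-insert m))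

  selfTileᴿ-diag : ∀ n → SelfTileᴿ (diag (tⁿ n))
  selfTileᴿ-diag zero    = selfTileᴿ-id
  selfTileᴿ-diag (suc n) = selfTileᴿ-≗ (diag-∷ (tⁿ n))
    (selfTileᴿ-∘ (selfTileᴿ-⊕ selfTileᴿ-diag₁ (selfTileᴿ-diag n))
                 (selfTileᴿ-⊕ selfTileᴿ-id (selfTileᴿ-insert n)))

  NoDisch⇒SelfTile : ∀ {a b} {α : OArr a b} → NoDisch α → SelfTile α
  NoDisch⇒SelfTile (nd-fun f) = pb-f f
  NoDisch⇒SelfTile (nd-id n)  = selfTile-idO
  NoDisch⇒SelfTile (nd-γ n m) =
    subst SelfTile (sym (γ-⟪⟫ (tⁿ n) (tⁿ m))) (selfTile (selfTileᴿ-swap n m))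
  NoDisch⇒SelfTile (nd-∇ n)   = subst SelfTile (sym (∇-⟪⟫ (tⁿ n))) (selfTile (selfTileᴿ-diag n))
  NoDisch⇒SelfTile (nd-⨾ d e) = selfTile-⨾ (NoDisch⇒SelfTile d) (NoDisch⇒SelfTile e)
  NoDisch⇒SelfTile (nd-⊗ d e) = selfTile-⊗ (NoDisch⇒SelfTile d) (NoDisch⇒SelfTile e)

proposition4p4 : (S : Signature) → let open Sig S in
    (P : Program) (c : Clause) → c ∈ P →
    (j : ℕ) (t₁' : OArr (tⁿ (Clause.nvars c)) (tⁿ j))
    (t₂' : OArr (tⁿ j) (tⁿ (Signature.par S (Clause.hd c)))) →
    headArr c ≡ t₁' ⨾ t₂' → NoDisch t₂' →
    Ent P (embO t₂' ⨾ᶜ predArr (Clause.hd c)) (idO {p ∷ []}) t₁' (bodyArr c)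
proposition4p4 S P c c∈P _ t₁' t₂' t≡t₁'⨾t₂' nd =
  Ent-cast refl refl refl (idC-⨾ᶜ (bodyArr c))
    (hor (tile-c c c∈P) (Ent-cast refl (sym t≡t₁'⨾t₂') refl refl t₂'-below-t₁'))
  where
  open Sig S
  open Arrows S
  open Tiles S P
  t₂'-below-t₁' : Ent P (embO t₂') (t₁' ⨾ t₂') t₁' idC
  t₂'-below-t₁' = selfTile-after t₁' (NoDisch⇒SelfTile nd)
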